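{- For every finite simple graph $G$, $$\alpha^{(1)}(G)\geq\alpha^{(2)}(G)\geq\cdots\geq\alpha^{(k)}(G)\geq\cdots\geq S(G)\geq\alpha(G),$$ i.e. $\alpha^{(k-1)}(G)\geq\alpha^{(k)}(G)\geq S(G)\geq\alpha(G)$ for every natural $k$ (with $k\geq2$ in the first inequality).
   Context: Let $G$ have $n$ vertices and let $d(v)$ denote the degree of $v$. For nonempty $W\subseteq V(G)$ and natural $k$, $D_k(W)=\left(\frac{1}{|W|}\sum_{v\in W}d^k(v)\right)^{1/k}$. $W$ is a small set if $d(v)\leq n-|W|$ for all $v\in W$; $W$ is a $\delta_k$-small set if $D_k(W)\leq n-|W|$. $\alpha^{(k)}(G)$ is the maximum number of vertices of a $\delta_k$-small set of $G$, $S(G)$ is the maximum number of vertices of a small set of $G$, and $\alpha(G)$ is the independence number of $G$. -}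

module Defs where

open import Data.Bool using (Bool; true; false)
open import Data.Nat using (ℕ; zero; suc; _+_; _*_; _∸_; _^_; _≤_)
open import Data.Fin using (Fin; zero; suc)
open import Data.Fin.Subset using (Subset; _∈_; ∣_∣; Nonempty)
open import Data.Vec using (tabulate; lookup)
open import Data.Product using (Σ; _×_)
open import Relation.Binary.PropositionalEquality using (_≡_)

record Graph (n : ℕ) : Set where
  field
    adj    : Fin n → Fin n → Bool
    sym    : ∀ u v → adj u v ≡ adj v u
    irrefl : ∀ v → adj v v ≡ false
open Graph public

N : ∀ {n} → Graph n → Fin n → Subset n
N G v = tabulate (adj G v)

deg : ∀ {n} → Graph n → Fin n → ℕ
deg G v = ∣ N G v ∣

sumFin : ∀ {n} → (Fin n → ℕ) → ℕ
sumFin {zero}  f = 0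
sumFin {suc n} f = f zero + sumFin (λ i → f (suc i))

indicator : Bool → ℕ → ℕ
indicator true  x = x
indicator false x = 0

powerSum : ∀ {n} → Graph n → ℕ → Subset n → ℕ
powerSum G k W = sumFin (λ v → indicator (lookup W v) (deg G v ^ k))

Small : ∀ {n} → Graph n → Subset n → Set
Small {n} G W = Nonempty W × (∀ v → v ∈ W → deg G v ≤ n ∸ ∣ W ∣)

-- W is a δ_k-small set: nonempty and D_k(W) ≤ n - |W|, where
-- D_k(W) = ((1/|W|) Σ_{v∈W} d(v)^k)^(1/k).  Since both sides are
-- nonnegative and |W| > 0, for k ≥ 1 this is literally equivalent to
-- Σ_{v∈W} d(v)^k ≤ |W| · (n - |W|)^k  (raise to the k-th power, clear |W|).
DeltaSmall : ∀ {n} → Graph n → ℕ → Subset n → Set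
DeltaSmall {n} G k W =
  Nonempty W × (powerSum G k W ≤ ∣ W ∣ * (n ∸ ∣ W ∣) ^ k)

Independent : ∀ {n} → Graph n → Subset n → Set
Independent G W = ∀ u v → u ∈ W → v ∈ W → adj G u v ≡ false

IsMaxCard : ∀ {n} → (Subset n → Set) → ℕ → Set
IsMaxCard {n} P m =
  Σ (Subset n) (λ W → P W × ∣ W ∣ ≡ m) × (∀ W → P W → ∣ W ∣ ≤ m)

IsAlphaK : ∀ {n} → Graph n → ℕ → ℕ → Set
IsAlphaK G k m = IsMaxCard (DeltaSmall G k) m

IsS : ∀ {n} → Graph n → ℕ → Set
IsS G m = IsMaxCard (Small G) m

IsAlpha : ∀ {n} → Graph n → ℕ → Set
IsAlpha G m = IsMaxCard (Independent G) m

-- Every independent set W is small, since N(v) misses W for v ∈ W; every small set is δ_k-small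
-- because the mean of d^k over W is at most the maximum. For the power means, weighted AM-GM gives
-- (k+1) c d^k ≤ k d^(k+1) + c^(k+1) for all d, c; summing over W with c = n - |W| shows that
-- Σ d^(k+1) ≤ |W| c^(k+1) forces Σ d^k ≤ |W| c^k, so δ_(k+1)-small sets are δ_k-small.
-- Comparing maxima of nested families of sets then gives the chain.
module Submission where

open import Defs hiding (sym)
open import Algebra.Properties.CommutativeSemigroup using (interchange)
open import Data.Bool using (true; false)
open import Data.Fin using (Fin; zero; suc)
open import Data.Fin.Subset using (Subset; _∈_; _⊆_; ∁; ∣_∣; Nonempty)
open import Data.Fin.Subset.Properties
  using (nonempty?; Empty-unique; ∣⊥∣≡0; p⊆q⇒∣p∣≤∣q∣; ∣∁p∣≡n∸∣p∣; x∉p⇒x∈∁p)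
open import Data.List using ([]; _∷_)
open import Data.Nat using (ℕ; zero; suc; _+_; _*_; _^_; _∸_; _≤_; z≤n; s≤s; NonZero)
open import Data.Nat.Properties
open import Data.Nat.Tactic.RingSolver using (solve)
open import Data.Product using (_×_; _,_)
open import Data.Sum using (inj₁; inj₂)
open import Data.Vec using (lookup; here; there)
open import Data.Vec.Properties using ([]=⇒lookup; lookup∘tabulate)
open import Function using (_∘_; case_of_)
open import Relation.Nullary using (yes; no)
open import Relation.Binary.PropositionalEquality using (_≡_; refl; sym; trans; cong; cong₂; module ≡-Reasoning)

sumOver : ∀ {n} → Subset n → (Fin n → ℕ) → ℕ
sumOver W f = sumFin (λ v → indicator (lookup W v) (f v))

-- Vec's constructors stay local: next to List's they would make the variable lists of solve ambiguous.
module _ where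
  open import Data.Vec using ([]; _∷_)

  sumOver-mono : ∀ {n} (W : Subset n) {f g : Fin n → ℕ} →
                 (∀ v → v ∈ W → f v ≤ g v) → sumOver W f ≤ sumOver W g
  sumOver-mono []          f≤g = z≤n
  sumOver-mono (true ∷ W)  f≤g =
    +-mono-≤ (f≤g zero here) (sumOver-mono W (λ v v∈W → f≤g (suc v) (there v∈W)))
  sumOver-mono (false ∷ W) f≤g = sumOver-mono W (λ v v∈W → f≤g (suc v) (there v∈W))

  sumOver-+ : ∀ {n} (W : Subset n) (f g : Fin n → ℕ) →
              sumOver W (λ v → f v + g v) ≡ sumOver W f + sumOver W g
  sumOver-+ []          f g = refl
  sumOver-+ (true ∷ W)  f g = begin
    (f zero + g zero) + sumOver W (λ v → f (suc v) + g (suc v))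
      ≡⟨ cong (f zero + g zero +_) (sumOver-+ W (f ∘ suc) (g ∘ suc)) ⟩
    (f zero + g zero) + (sumOver W (f ∘ suc) + sumOver W (g ∘ suc))
      ≡⟨ interchange +-commutativeSemigroup (f zero) (g zero) _ _ ⟩
    (f zero + sumOver W (f ∘ suc)) + (g zero + sumOver W (g ∘ suc)) ∎
    where open ≡-Reasoning
  sumOver-+ (false ∷ W) f g = sumOver-+ W (f ∘ suc) (g ∘ suc)

  sumOver-*ˡ : ∀ {n} (W : Subset n) (c : ℕ) (f : Fin n → ℕ) →
               sumOver W (λ v → c * f v) ≡ c * sumOver W f
  sumOver-*ˡ []          c f = sym (*-zeroʳ c)
  sumOver-*ˡ (true ∷ W)  c f = trans (cong (c * f zero +_) (sumOver-*ˡ W c (f ∘ suc)))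
                                     (sym (*-distribˡ-+ c (f zero) _))
  sumOver-*ˡ (false ∷ W) c f = sumOver-*ˡ W c (f ∘ suc)

  sumOver-const : ∀ {n} (W : Subset n) (x : ℕ) → sumOver W (λ _ → x) ≡ ∣ W ∣ * x
  sumOver-const []          x = refl
  sumOver-const (true ∷ W)  x = cong (x +_) (sumOver-const W x)
  sumOver-const (false ∷ W) x = sumOver-const W x

m≤n⇒2*m*n≤m*m+n*n : ∀ {m n} → m ≤ n → 2 * m * n ≤ m * m + n * n
m≤n⇒2*m*n≤m*m+n*n {m} m≤n with m≤n⇒∃[o]m+o≡n m≤n
... | o , refl = begin
  2 * m * (m + o)                     ≤⟨ m≤m+n _ (o * o) ⟩
  2 * m * (m + o) + o * o             ≡⟨ solve (m ∷ o ∷ []) ⟩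
  m * m + (m + o) * (m + o)           ∎
  where open ≤-Reasoning

2*m*n≤m*m+n*n : ∀ m n → 2 * m * n ≤ m * m + n * n
2*m*n≤m*m+n*n m n with ≤-total m n
... | inj₁ m≤n = m≤n⇒2*m*n≤m*m+n*n m≤n
... | inj₂ n≤m = begin
  2 * m * n     ≡⟨ solve (m ∷ n ∷ []) ⟩
  2 * n * m     ≤⟨ m≤n⇒2*m*n≤m*m+n*n n≤m ⟩
  n * n + m * m ≡⟨ +-comm (n * n) (m * m) ⟩
  m * m + n * n ∎
  where open ≤-Reasoning

weighted-am-gm-step : ∀ j c d D E → (1 + j) * (c * D) ≤ j * (d * D) + c * E →
                      (2 + j) * (c * (d * D)) ≤ (1 + j) * (d * (d * D)) + c * (c * E)
weighted-am-gm-step j c d D E ih = +-cancelʳ-≤ (j * (c * (d * D))) _ _ (begin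
  (2 + j) * (c * (d * D)) + j * (c * (d * D))       ≡⟨ solve (j ∷ c ∷ d ∷ D ∷ []) ⟩
  (1 + j) * D * (2 * c * d)                          ≤⟨ *-monoʳ-≤ ((1 + j) * D) (2*m*n≤m*m+n*n c d) ⟩
  (1 + j) * D * (c * c + d * d)                      ≡⟨ solve (j ∷ c ∷ d ∷ D ∷ []) ⟩
  (1 + j) * (d * (d * D)) + c * ((1 + j) * (c * D))  ≤⟨ +-monoʳ-≤ _ (*-monoʳ-≤ c ih) ⟩
  (1 + j) * (d * (d * D)) + c * (j * (d * D) + c * E) ≡⟨ solve (j ∷ c ∷ d ∷ D ∷ E ∷ []) ⟩
  ((1 + j) * (d * (d * D)) + c * (c * E)) + j * (c * (d * D)) ∎)
  where open ≤-Reasoning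

weighted-am-gm : ∀ j c d → (1 + j) * (c * d ^ j) ≤ j * d ^ (1 + j) + c ^ (1 + j)
weighted-am-gm zero    c d = ≤-reflexive (+-identityʳ (c * 1))
weighted-am-gm (suc j) c d = weighted-am-gm-step j c d (d ^ j) (c ^ j) (weighted-am-gm j c d)

m^[1+n]≤m^[2+n] : ∀ m n → m ^ (1 + n) ≤ m ^ (2 + n)
m^[1+n]≤m^[2+n] zero    n = z≤n
m^[1+n]≤m^[2+n] (suc m) n = m≤n*m (suc m ^ (1 + n)) (suc m)

amgm-bound⇒≤ : ∀ k m c X P Q .{{_ : NonZero c}} →
               (1 + k) * (c * P) ≤ k * Q + m * (c * X) → Q ≤ m * (c * X) → P ≤ m * X
amgm-bound⇒≤ k m c X P Q amgm Q≤ = *-cancelˡ-≤ c (*-cancelˡ-≤ (1 + k) (begin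
  (1 + k) * (c * P)             ≤⟨ amgm ⟩
  k * Q + m * (c * X)           ≤⟨ +-monoˡ-≤ _ (*-monoʳ-≤ k Q≤) ⟩
  k * (m * (c * X)) + m * (c * X) ≡⟨ solve (k ∷ m ∷ c ∷ X ∷ []) ⟩
  (1 + k) * (c * (m * X))       ∎))
  where open ≤-Reasoning

sumOver-^-bound-pred : ∀ {n} (W : Subset n) (f : Fin n → ℕ) (c j : ℕ) →
                       sumOver W (λ v → f v ^ (2 + j)) ≤ ∣ W ∣ * c ^ (2 + j) →
                       sumOver W (λ v → f v ^ (1 + j)) ≤ ∣ W ∣ * c ^ (1 + j)
sumOver-^-bound-pred W f zero    j bound =
  ≤-trans (sumOver-mono W (λ v _ → m^[1+n]≤m^[2+n] (f v) j)) bound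
sumOver-^-bound-pred W f c@(suc _) j bound =
  amgm-bound⇒≤ (1 + j) ∣ W ∣ c (c ^ (1 + j)) _ _ summed-am-gm bound
  where
  summed-am-gm : (2 + j) * (c * sumOver W (λ v → f v ^ (1 + j)))
               ≤ (1 + j) * sumOver W (λ v → f v ^ (2 + j)) + ∣ W ∣ * c ^ (2 + j)
  summed-am-gm = begin
    (2 + j) * (c * sumOver W (λ v → f v ^ (1 + j)))
      ≡⟨ sym (trans (sumOver-*ˡ W (2 + j) _) (cong ((2 + j) *_) (sumOver-*ˡ W c _))) ⟩
    sumOver W (λ v → (2 + j) * (c * f v ^ (1 + j)))
      ≤⟨ sumOver-mono W (λ v _ → weighted-am-gm (1 + j) c (f v)) ⟩
    sumOver W (λ v → (1 + j) * f v ^ (2 + j) + c ^ (2 + j))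
      ≡⟨ trans (sumOver-+ W _ _) (cong₂ _+_ (sumOver-*ˡ W (1 + j) _) (sumOver-const W _)) ⟩
    (1 + j) * sumOver W (λ v → f v ^ (2 + j)) + ∣ W ∣ * c ^ (2 + j) ∎
    where open ≤-Reasoning

module _ {n : ℕ} (G : Graph n) where

  deltaSmall-pred : ∀ j W → DeltaSmall G (2 + j) W → DeltaSmall G (1 + j) W
  deltaSmall-pred j W (ne , bound) = ne , sumOver-^-bound-pred W (deg G) (n ∸ ∣ W ∣) j bound

  small⇒deltaSmall : ∀ k W → Small G W → DeltaSmall G k W
  small⇒deltaSmall k W (ne , small) = ne , (begin
    sumOver W (λ v → deg G v ^ k)        ≤⟨ sumOver-mono W (λ v v∈W → ^-monoˡ-≤ k (small v v∈W)) ⟩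
    sumOver W (λ _ → (n ∸ ∣ W ∣) ^ k)   ≡⟨ sumOver-const W _ ⟩
    ∣ W ∣ * (n ∸ ∣ W ∣) ^ k              ∎)
    where open ≤-Reasoning

  N⊆∁ : ∀ {W v} → Independent G W → v ∈ W → N G v ⊆ ∁ W
  N⊆∁ {W} {v} independent v∈W {u} u∈N = x∉p⇒x∈∁p λ u∈W →
    case trans (sym (independent v u v∈W u∈W)) uv-adjacent of λ ()
    where
    uv-adjacent : adj G v u ≡ true
    uv-adjacent = trans (sym (lookup∘tabulate (adj G v) u)) ([]=⇒lookup u∈N)

  independent⇒small : ∀ W → Independent G W → Nonempty W → Small G W
  independent⇒small W independent ne = ne , λ v v∈W →
    ≤-trans (p⊆q⇒∣p∣≤∣q∣ (N⊆∁ independent v∈W)) (≤-reflexive (∣∁p∣≡n∸∣p∣ W))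

isMaxCard-≤ : ∀ {n} {P Q : Subset n → Set} {a b} →
              (∀ W → P W → Nonempty W → Q W) → IsMaxCard P a → IsMaxCard Q b → a ≤ b
isMaxCard-≤ {n} P⇒Q ((W , PW , refl) , _) (_ , maximal) with nonempty? W
... | yes ne    = maximal W (P⇒Q W PW ne)
... | no empty  = ≤-trans (≤-reflexive (trans (cong ∣_∣ (Empty-unique empty)) (∣⊥∣≡0 n))) z≤n

proposition5p1 : ∀ (n : ℕ) (G : Graph n) →
    (∀ k → 2 ≤ k → ∀ a b → IsAlphaK G (k ∸ 1) a → IsAlphaK G k b → b ≤ a)
    × (∀ k → 1 ≤ k → ∀ a s → IsAlphaK G k a → IsS G s → s ≤ a)
    × (∀ s i → IsS G s → IsAlpha G i → i ≤ s)
proposition5p1 n G = alphaK-antitone , S≤alphaK , alpha≤S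
  where
  alphaK-antitone : ∀ k → 2 ≤ k → ∀ a b → IsAlphaK G (k ∸ 1) a → IsAlphaK G k b → b ≤ a
  alphaK-antitone (suc (suc j)) (s≤s (s≤s z≤n)) _ _ αₖ₋₁ αₖ =
    isMaxCard-≤ (λ W δ _ → deltaSmall-pred G j W δ) αₖ αₖ₋₁

  S≤alphaK : ∀ k → 1 ≤ k → ∀ a s → IsAlphaK G k a → IsS G s → s ≤ a
  S≤alphaK k _ _ _ αₖ S = isMaxCard-≤ (λ W small _ → small⇒deltaSmall G k W small) S αₖ

  alpha≤S : ∀ s i → IsS G s → IsAlpha G i → i ≤ s
  alpha≤S _ _ S α = isMaxCard-≤ (independent⇒small G) α S
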